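{- Let $v$ be a positive integer, $t\in\mathbb{N}$, and $b\in\mathbb{N}$ with $b<2^v$. Let $m=\alpha(b)$. Then $$\Phi\left(\bar{b}_{v,t}\right)=\Phi\left(\bar{b}_{v,\infty}\right)-\frac{\Phi\left(\bar{b}_{v,\infty}\right)}{3^{mt}}2^{tv}.$$
   Context: $\mathbb{Z}_2$ is the ring of $2$-adic integers; $\mathbb{N}=\{0,1,2,\dots\}$. The map $\Phi:\mathbb{Z}_2\to\mathbb{Z}_2$ is defined as follows: if $x=\sum_i 2^{e_i}$ with $0\leq e_0<e_1<\cdots$ (finite or infinite sum; $x=0$ is the empty sum), then $\Phi(x)=-\sum_i 2^{e_i}3^{ -i}$ ($\Phi(0)=0$). For $b\in\mathbb{N}$, $\alpha(b)$ is the number of ones in the binary expansion of $b$. For $b,v,t\in\mathbb{N}$, $\bar{b}_{v,t}=b\sum_{i=0}^{t-1}2^{vi}$ and $\bar{b}_{v,\infty}=b\sum_{i=0}^{\infty}2^{vi}$ (a $2$-adic integer). -}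

module Defs where

open import Data.Nat as ℕ using (ℕ; zero; suc; NonZero)
open import Data.Nat.Properties using (m^n≢0)
open import Data.Integer as ℤ using (ℤ; +_; _%ℕ_)
open import Data.Integer.Divisibility as ℤ∣ using ()

sumℕ : ℕ → (ℕ → ℕ) → ℕ
sumℕ zero    f = 0
sumℕ (suc n) f = sumℕ n f ℕ.+ f n

sumℤ : ℕ → (ℕ → ℤ) → ℤ
sumℤ zero    f = + 0
sumℤ (suc n) f = sumℤ n f ℤ.+ f n

powℤ : ℤ → ℕ → ℤ
powℤ a zero    = + 1
powℤ a (suc k) = a ℤ.* powℤ a k

bitℕ : ℕ → ℕ → ℕ
bitℕ n k = (ℕ._/_ n (2 ℕ.^ k) {{m^n≢0 2 k}}) ℕ.% 2

-- α(b) = number of ones in the binary expansion of b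
-- (all digits of b at positions ≥ b vanish since b < 2^b)
α : ℕ → ℕ
α b = sumℕ b (bitℕ b)

-- 2-adic integers, as (Cauchy) sequences of integer approximations:
-- x represents lim x n, where x (suc n) ≡ x n (mod 2^n).
-- Two 2-adic integers are equal iff x n ≡ y n (mod 2^n) for every n.
ℤ₂ : Set
ℤ₂ = ℕ → ℤ

infix 4 _≈₂_
_≈₂_ : ℤ₂ → ℤ₂ → Set
x ≈₂ y = ∀ n → (+ (2 ℕ.^ n)) ℤ∣.∣ (x n ℤ.- y n)

infixl 6 _+₂_ _-₂_
infixl 7 _*₂_
_+₂_ : ℤ₂ → ℤ₂ → ℤ₂
(x +₂ y) n = x n ℤ.+ y n

_-₂_ : ℤ₂ → ℤ₂ → ℤ₂
(x -₂ y) n = x n ℤ.- y n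

_*₂_ : ℤ₂ → ℤ₂ → ℤ₂
(x *₂ y) n = x n ℤ.* y n

-₂_ : ℤ₂ → ℤ₂
(-₂ x) n = ℤ.- x n

_^₂_ : ℤ₂ → ℕ → ℤ₂
(x ^₂ k) n = powℤ (x n) k

ι : ℕ → ℤ₂
ι a n = + a

-- 3⁻¹ ∈ ℤ₂ :  1/3 = 1/(1+2) = Σ_j (-2)^j
inv3 : ℤ₂
inv3 n = sumℤ n (λ j → powℤ (ℤ.- (+ 2)) j)

-- The map Φ.
-- k-th binary digit of x ∈ ℤ₂ (read off from x (k+1), which determines x mod 2^(k+1))
digit : ℤ₂ → ℕ → ℕ
digit x k = ℕ._/_ (_%ℕ_ (x (suc k)) (2 ℕ.^ suc k) {{m^n≢0 2 (suc k)}})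
                  (2 ℕ.^ k) {{m^n≢0 2 k}}

-- number of ones of x strictly below position k; if the digit at k is 1,
-- then k = e_i with i = ones-below x k
ones-below : ℤ₂ → ℕ → ℕ
ones-below x k = sumℕ k (digit x)

-- Φ(x) = - Σ_i 2^{e_i} 3^{-i}, reindexed over digit positions k = e_i;
-- the n-th approximation keeps the terms with e_i < n (the others are ≡ 0 mod 2^n).
Φ : ℤ₂ → ℤ₂
Φ x n = ℤ.- sumℤ n (λ k → (+ digit x k) ℤ.* (+ (2 ℕ.^ k))
                            ℤ.* powℤ (inv3 n) (ones-below x k))

bbar : ℕ → ℕ → ℕ → ℕ
bbar b v t = b ℕ.* sumℕ t (λ i → 2 ℕ.^ (v ℕ.* i))

-- b̄_{v,∞} = b Σ_{i≥0} 2^{vi} ∈ ℤ₂, as the sequence of its partial sums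
-- (for v ≥ 1 the terms with i ≥ n are ≡ 0 mod 2^n)
bbar∞ : ℕ → ℕ → ℤ₂
bbar∞ b v n = + bbar b v n

{-# OPTIONS --safe #-}
-- Write Φ(x) = -Σ_k d_k 2^k I^(o_k), where d_k is the k-th binary digit of x, o_k the number of
-- ones below position k, and I = 3⁻¹. The digits of b̄_{v,∞} are those of b repeated with period v,
-- so shifting by s = tv multiplies each term by 2^s I^(mt); b̄_{v,t} has the same digits below s and
-- none above. Hence Φ(b̄_{v,∞}) = Φ(b̄_{v,t}) + 2^s I^(mt) Φ(b̄_{v,∞}). Modulo 2^n every sum may be
-- extended past position n at no cost, because the k-th term is divisible by 2^k.
module Submission where

open import Defs

module NatSums where

  open import Data.Nat using (ℕ; zero; suc; _+_; _*_; _<_)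
  open import Data.Nat.Properties
    using (m<n⇒m<1+n; ≤-refl; +-assoc; +-identityʳ; +-suc; *-zeroʳ; *-distribˡ-+)
  open import Relation.Binary.PropositionalEquality
  open ≡-Reasoning

  sumℕ-cong : ∀ n {f g} → (∀ j → j < n → f j ≡ g j) → sumℕ n f ≡ sumℕ n g
  sumℕ-cong zero    f≡g = refl
  sumℕ-cong (suc n) f≡g =
    cong₂ _+_ (sumℕ-cong n (λ j j<n → f≡g j (m<n⇒m<1+n j<n))) (f≡g n ≤-refl)

  sumℕ-+ : ∀ m n f → sumℕ (m + n) f ≡ sumℕ m f + sumℕ n (λ j → f (m + j))
  sumℕ-+ m zero    f = trans (cong (λ l → sumℕ l f) (+-identityʳ m)) (sym (+-identityʳ _))
  sumℕ-+ m (suc n) f = begin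
    sumℕ (m + suc n) f                                  ≡⟨ cong (λ l → sumℕ l f) (+-suc m n) ⟩
    sumℕ (m + n) f + f (m + n)                          ≡⟨ cong (_+ f (m + n)) (sumℕ-+ m n f) ⟩
    sumℕ m f + sumℕ n (λ j → f (m + j)) + f (m + n)     ≡⟨ +-assoc (sumℕ m f) _ _ ⟩
    sumℕ m f + (sumℕ n (λ j → f (m + j)) + f (m + n))   ∎

  sumℕ-zeros : ∀ n {f} → (∀ j → f j ≡ 0) → sumℕ n f ≡ 0
  sumℕ-zeros zero    f≡0 = refl
  sumℕ-zeros (suc n) f≡0 = cong₂ _+_ (sumℕ-zeros n f≡0) (f≡0 n)

  sumℕ-*ˡ : ∀ n c f → sumℕ n (λ i → c * f i) ≡ c * sumℕ n f
  sumℕ-*ˡ zero    c f = sym (*-zeroʳ c)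
  sumℕ-*ˡ (suc n) c f =
    trans (cong (_+ c * f n) (sumℕ-*ˡ n c f)) (sym (*-distribˡ-+ c (sumℕ n f) (f n)))

  sumℕ-periodic : ∀ t p {f} → (∀ k → f (p + k) ≡ f k) → sumℕ (t * p) f ≡ t * sumℕ p f
  sumℕ-periodic zero    p f-per = refl
  sumℕ-periodic (suc t) p {f} f-per = begin
    sumℕ (p + t * p) f                             ≡⟨ sumℕ-+ p (t * p) f ⟩
    sumℕ p f + sumℕ (t * p) (λ k → f (p + k))      ≡⟨ cong (sumℕ p f +_) (sumℕ-cong (t * p) (λ k _ → f-per k)) ⟩
    sumℕ p f + sumℕ (t * p) f                      ≡⟨ cong (sumℕ p f +_) (sumℕ-periodic t p f-per) ⟩
    sumℕ p f + t * sumℕ p f                        ∎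

module IntSums where

  open import Data.Nat as ℕ using (zero; suc; _<_)
  import Data.Nat.Properties as ℕ
  open import Data.Integer using (ℤ; +_; _+_; _*_)
  open import Data.Integer.Properties using (+-identityʳ; +-assoc; *-zeroˡ; *-distribʳ-+)
  open import Relation.Binary.PropositionalEquality
  open ≡-Reasoning

  sumℤ-cong : ∀ n {f g} → (∀ j → j < n → f j ≡ g j) → sumℤ n f ≡ sumℤ n g
  sumℤ-cong zero    f≡g = refl
  sumℤ-cong (suc n) f≡g =
    cong₂ _+_ (sumℤ-cong n (λ j j<n → f≡g j (ℕ.m<n⇒m<1+n j<n))) (f≡g n ℕ.≤-refl)

  sumℤ-+ : ∀ m n f → sumℤ (m ℕ.+ n) f ≡ sumℤ m f + sumℤ n (λ j → f (m ℕ.+ j))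
  sumℤ-+ m zero    f = trans (cong (λ l → sumℤ l f) (ℕ.+-identityʳ m)) (sym (+-identityʳ _))
  sumℤ-+ m (suc n) f = begin
    sumℤ (m ℕ.+ suc n) f                                  ≡⟨ cong (λ l → sumℤ l f) (ℕ.+-suc m n) ⟩
    sumℤ (m ℕ.+ n) f + f (m ℕ.+ n)                        ≡⟨ cong (_+ f (m ℕ.+ n)) (sumℤ-+ m n f) ⟩
    sumℤ m f + sumℤ n (λ j → f (m ℕ.+ j)) + f (m ℕ.+ n)   ≡⟨ +-assoc (sumℤ m f) _ _ ⟩
    sumℤ m f + (sumℤ n (λ j → f (m ℕ.+ j)) + f (m ℕ.+ n)) ∎

  sumℤ-zeros : ∀ n {f} → (∀ j → f j ≡ + 0) → sumℤ n f ≡ + 0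
  sumℤ-zeros zero    f≡0 = refl
  sumℤ-zeros (suc n) f≡0 = cong₂ _+_ (sumℤ-zeros n f≡0) (f≡0 n)

  sumℤ-*ʳ : ∀ n f c → sumℤ n f * c ≡ sumℤ n (λ k → f k * c)
  sumℤ-*ʳ zero    f c = *-zeroˡ c
  sumℤ-*ʳ (suc n) f c =
    trans (*-distribʳ-+ c (sumℤ n f) (f n)) (cong (_+ f n * c) (sumℤ-*ʳ n f c))

module Binary where

  open import Data.Nat using (ℕ; zero; suc; _+_; _*_; _^_; _<_; _%_; _/_; NonZero; z≤n; s≤s)
  open import Data.Nat.Properties
  open import Data.Nat.DivMod
  open import Data.Nat.Divisibility using (divides-refl)
  open import Data.Product using (_,_)
  open import Data.Sum using (inj₁; inj₂)
  open import Relation.Binary.PropositionalEquality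
  open import Data.Nat.Tactic.RingSolver using (solve-∀)
  open ≡-Reasoning
  open NatSums

  [m+kn]/n≡m/n+k : ∀ m k n .{{_ : NonZero n}} → (m + k * n) / n ≡ m / n + k
  [m+kn]/n≡m/n+k m k n = trans (+-distrib-/-∣ʳ m (divides-refl k)) (cong (m / n +_) (m*n/n≡m k n))

  n<2^n : ∀ n → n < 2 ^ n
  n<2^n zero    = s≤s z≤n
  n<2^n (suc n) = subst (suc n <_) (cong (2 ^ n +_) (sym (+-identityʳ (2 ^ n))))
                        (+-mono-≤ (m^n>0 2 n) (n<2^n n))

  bitℕ-+-even : ∀ a Y k → bitℕ (a + Y * 2 * 2 ^ k) k ≡ bitℕ a k
  bitℕ-+-even a Y k = begin
    (a + Y * 2 * 2 ^ k) / 2 ^ k % 2   ≡⟨ cong (_% 2) ([m+kn]/n≡m/n+k a (Y * 2) (2 ^ k)) ⟩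
    (a / 2 ^ k + Y * 2) % 2           ≡⟨ [m+kn]%n≡m%n (a / 2 ^ k) Y 2 ⟩
    a / 2 ^ k % 2                     ∎
    where instance _ = m^n≢0 2 k

  bitℕ-+-low : ∀ a X {v k} → k < v → bitℕ (a + 2 ^ v * X) k ≡ bitℕ a k
  bitℕ-+-low a X {k = k} k<v with m≤n⇒∃[o]m+o≡n k<v
  ... | r , refl = trans (cong (λ z → bitℕ (a + z) k) high-part) (bitℕ-+-even a (2 ^ r * X) k)
    where
    high-part : 2 ^ (suc k + r) * X ≡ 2 ^ r * X * 2 * 2 ^ k
    high-part = trans (cong (λ z → 2 * z * X) (^-distribˡ-+-* 2 k r))
                      (rearrange (2 ^ k) (2 ^ r) X)
      where
      rearrange : ∀ p q x → 2 * (p * q) * x ≡ q * x * 2 * p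
      rearrange = solve-∀

  bitℕ-+-high : ∀ a X v j → a < 2 ^ v → bitℕ (a + 2 ^ v * X) (v + j) ≡ bitℕ X j
  bitℕ-+-high a X v j a<2^v = cong (_% 2) (begin
    (a + 2 ^ v * X) / 2 ^ (v + j)           ≡⟨ /-congʳ (^-distribˡ-+-* 2 v j) ⟩
    (a + 2 ^ v * X) / (2 ^ v * 2 ^ j)       ≡⟨ m/n/o≡m/[n*o] (a + 2 ^ v * X) (2 ^ v) (2 ^ j) ⟨
    (a + 2 ^ v * X) / 2 ^ v / 2 ^ j         ≡⟨ cong (_/ 2 ^ j) low-part-drops ⟩
    X / 2 ^ j                               ∎)
    where
    instance
      _ = m^n≢0 2 v
      _ = m^n≢0 2 j
      _ = m^n≢0 2 (v + j)
      _ = m*n≢0 (2 ^ v) (2 ^ j)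
    low-part-drops : (a + 2 ^ v * X) / 2 ^ v ≡ X
    low-part-drops = begin
      (a + 2 ^ v * X) / 2 ^ v    ≡⟨ cong (λ z → (a + z) / 2 ^ v) (*-comm (2 ^ v) X) ⟩
      (a + X * 2 ^ v) / 2 ^ v    ≡⟨ [m+kn]/n≡m/n+k a X (2 ^ v) ⟩
      a / 2 ^ v + X              ≡⟨ cong (_+ X) (m<n⇒m/n≡0 a<2^v) ⟩
      X                          ∎

  bitℕ-≥ : ∀ {a} k → a < 2 ^ k → bitℕ a k ≡ 0
  bitℕ-≥ k a<2^k = cong (_% 2) (m<n⇒m/n≡0 {{m^n≢0 2 k}} a<2^k)

  sumℕ-bitℕ-stable : ∀ a m n → a < 2 ^ m → sumℕ (m + n) (bitℕ a) ≡ sumℕ m (bitℕ a)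
  sumℕ-bitℕ-stable a m n a<2^m = begin
    sumℕ (m + n) (bitℕ a)                                 ≡⟨ sumℕ-+ m n (bitℕ a) ⟩
    sumℕ m (bitℕ a) + sumℕ n (λ j → bitℕ a (m + j))       ≡⟨ cong (sumℕ m (bitℕ a) +_) (sumℕ-zeros n high) ⟩
    sumℕ m (bitℕ a) + 0                                   ≡⟨ +-identityʳ _ ⟩
    sumℕ m (bitℕ a)                                       ∎
    where
    high : ∀ j → bitℕ a (m + j) ≡ 0
    high j = bitℕ-≥ (m + j) (<-≤-trans a<2^m (^-monoʳ-≤ 2 (m≤m+n m j)))

  α≡sum-bitℕ : ∀ {b} v → b < 2 ^ v → α b ≡ sumℕ v (bitℕ b)
  α≡sum-bitℕ {b} v b<2^v with ≤-total v b
  ... | inj₁ v≤b with m≤n⇒∃[o]m+o≡n v≤b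
  ...   | c , refl = sumℕ-bitℕ-stable b v c b<2^v
  α≡sum-bitℕ {b} v b<2^v | inj₂ b≤v with m≤n⇒∃[o]m+o≡n b≤v
  ...   | c , refl = sym (sumℕ-bitℕ-stable b b c (n<2^n b))

module Digits where

  open import Data.Nat using (ℕ; zero; suc; _+_; _*_; _^_; _<_; _≤_; _%_; NonZero)
  open import Data.Nat.Properties
  open import Data.Nat.DivMod
  open import Data.Product using (_,_)
  open import Relation.Nullary using (yes; no)
  open import Relation.Binary.PropositionalEquality
  open import Data.Nat.Tactic.RingSolver using (solve-∀)
  open ≡-Reasoning
  open NatSums
  open Binary

  digit-ι : ∀ a k → digit (ι a) k ≡ bitℕ a k
  digit-ι a k = m%[n*o]/o≡m/o%n a 2 (2 ^ k) {{_}} {{m^n≢0 2 k}} {{m^n≢0 2 (suc k)}}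

  ones-below-+ : ∀ {x} s k → (∀ k → digit x (s + k) ≡ digit x k) →
                 ones-below x (s + k) ≡ ones-below x s + ones-below x k
  ones-below-+ {x} s k periodic =
    trans (sumℕ-+ s k (digit x)) (cong (ones-below x s +_) (sumℕ-cong k (λ j _ → periodic j)))

  periodic-* : ∀ {A : Set} {f : ℕ → A} p → (∀ k → f (p + k) ≡ f k) → ∀ t k → f (t * p + k) ≡ f k
  periodic-* p periodic zero    k = refl
  periodic-* {f = f} p periodic (suc t) k =
    trans (cong f (+-assoc p (t * p) k)) (trans (periodic (t * p + k)) (periodic-* p periodic t k))

  geometric-suc : ∀ v N → sumℕ (suc N) (λ i → 2 ^ (v * i)) ≡ 1 + 2 ^ v * sumℕ N (λ i → 2 ^ (v * i))
  geometric-suc v N = begin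
    sumℕ (suc N) (λ i → 2 ^ (v * i))               ≡⟨ sumℕ-+ 1 N (λ i → 2 ^ (v * i)) ⟩
    2 ^ (v * 0) + sumℕ N (λ i → 2 ^ (v * suc i))   ≡⟨ cong₂ _+_ (cong (2 ^_) (*-zeroʳ v))
                                                                (sumℕ-cong N (λ i _ → shift i)) ⟩
    1 + sumℕ N (λ i → 2 ^ v * 2 ^ (v * i))         ≡⟨ cong (1 +_) (sumℕ-*ˡ N (2 ^ v) (λ i → 2 ^ (v * i))) ⟩
    1 + 2 ^ v * sumℕ N (λ i → 2 ^ (v * i))         ∎
    where
    shift : ∀ i → 2 ^ (v * suc i) ≡ 2 ^ v * 2 ^ (v * i)
    shift i = trans (cong (2 ^_) (*-suc v i)) (^-distribˡ-+-* 2 v (v * i))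

  bbar-suc : ∀ b v N → bbar b v (suc N) ≡ b + 2 ^ v * bbar b v N
  bbar-suc b v N = trans (cong (b *_) (geometric-suc v N)) (distribute b (2 ^ v) _)
    where
    distribute : ∀ b p s → b * (1 + p * s) ≡ b + p * (b * s)
    distribute = solve-∀

  module _ {b v : ℕ} .{{_ : NonZero v}} (b<2^v : b < 2 ^ v) where

    [v+k]%v≡k%v : ∀ k → (v + k) % v ≡ k % v
    [v+k]%v≡k%v k = trans (cong (_% v) (+-comm v k)) ([m+n]%n≡m%n k v)

    bitℕ-bbar-< : ∀ N k → k < N * v → bitℕ (bbar b v N) k ≡ bitℕ b (k % v)
    bitℕ-bbar-< zero    k ()
    bitℕ-bbar-< (suc N) k k<N'v with k <? v
    ... | yes k<v = begin
      bitℕ (bbar b v (suc N)) k         ≡⟨ cong (λ z → bitℕ z k) (bbar-suc b v N) ⟩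
      bitℕ (b + 2 ^ v * bbar b v N) k   ≡⟨ bitℕ-+-low b (bbar b v N) k<v ⟩
      bitℕ b k                          ≡⟨ cong (bitℕ b) (m<n⇒m%n≡m k<v) ⟨
      bitℕ b (k % v)                    ∎
    ... | no k≮v with m≤n⇒∃[o]m+o≡n (≮⇒≥ k≮v)
    ...   | j , refl = begin
      bitℕ (bbar b v (suc N)) (v + j)         ≡⟨ cong (λ z → bitℕ z (v + j)) (bbar-suc b v N) ⟩
      bitℕ (b + 2 ^ v * bbar b v N) (v + j)   ≡⟨ bitℕ-+-high b (bbar b v N) v j b<2^v ⟩
      bitℕ (bbar b v N) j                     ≡⟨ bitℕ-bbar-< N j (+-cancelˡ-< v j (N * v) k<N'v) ⟩
      bitℕ b (j % v)                          ≡⟨ cong (bitℕ b) ([v+k]%v≡k%v j) ⟨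
      bitℕ b ((v + j) % v)                    ∎

    bitℕ-bbar-≥ : ∀ N k → N * v ≤ k → bitℕ (bbar b v N) k ≡ 0
    bitℕ-bbar-≥ zero    k _    = bitℕ-≥ k (subst (_< 2 ^ k) (sym (*-zeroʳ b)) (m^n>0 2 k))
    bitℕ-bbar-≥ (suc N) k N'v≤k with m≤n⇒∃[o]m+o≡n (≤-trans (m≤m+n v (N * v)) N'v≤k)
    ... | j , refl = begin
      bitℕ (bbar b v (suc N)) (v + j)         ≡⟨ cong (λ z → bitℕ z (v + j)) (bbar-suc b v N) ⟩
      bitℕ (b + 2 ^ v * bbar b v N) (v + j)   ≡⟨ bitℕ-+-high b (bbar b v N) v j b<2^v ⟩
      bitℕ (bbar b v N) j                     ≡⟨ bitℕ-bbar-≥ N j (+-cancelˡ-≤ v (N * v) j N'v≤k) ⟩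
      0                                       ∎

    digit-bbar∞ : ∀ k → digit (bbar∞ b v) k ≡ bitℕ b (k % v)
    digit-bbar∞ k = trans (digit-ι (bbar b v (suc k)) k) (bitℕ-bbar-< (suc k) k (m≤m*n (suc k) v))

    digit-bbar∞-periodic : ∀ k → digit (bbar∞ b v) (v + k) ≡ digit (bbar∞ b v) k
    digit-bbar∞-periodic k = begin
      digit (bbar∞ b v) (v + k)     ≡⟨ digit-bbar∞ (v + k) ⟩
      bitℕ b ((v + k) % v)          ≡⟨ cong (bitℕ b) ([v+k]%v≡k%v k) ⟩
      bitℕ b (k % v)                ≡⟨ digit-bbar∞ k ⟨
      digit (bbar∞ b v) k           ∎

    digit-bbar-< : ∀ t k → k < t * v → digit (ι (bbar b v t)) k ≡ digit (bbar∞ b v) k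
    digit-bbar-< t k k<tv = begin
      digit (ι (bbar b v t)) k    ≡⟨ digit-ι (bbar b v t) k ⟩
      bitℕ (bbar b v t) k         ≡⟨ bitℕ-bbar-< t k k<tv ⟩
      bitℕ b (k % v)              ≡⟨ digit-bbar∞ k ⟨
      digit (bbar∞ b v) k         ∎

    digit-bbar-≥ : ∀ t k → t * v ≤ k → digit (ι (bbar b v t)) k ≡ 0
    digit-bbar-≥ t k tv≤k = trans (digit-ι (bbar b v t) k) (bitℕ-bbar-≥ t k tv≤k)

    ones-below-bbar∞ : ∀ t → ones-below (bbar∞ b v) (t * v) ≡ α b * t
    ones-below-bbar∞ t = begin
      sumℕ (t * v) (digit (bbar∞ b v))  ≡⟨ sumℕ-periodic t v digit-bbar∞-periodic ⟩
      t * sumℕ v (digit (bbar∞ b v))    ≡⟨ cong (t *_) (sumℕ-cong v first-period) ⟩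
      t * sumℕ v (bitℕ b)               ≡⟨ cong (t *_) (α≡sum-bitℕ v b<2^v) ⟨
      t * α b                           ≡⟨ *-comm t (α b) ⟩
      α b * t                           ∎
      where
      first-period : ∀ k → k < v → digit (bbar∞ b v) k ≡ bitℕ b k
      first-period k k<v = trans (digit-bbar∞ k) (cong (bitℕ b) (m<n⇒m%n≡m k<v))

module Truncation where

  open import Data.Nat as ℕ using (ℕ; _^_; _<_; _≤_)
  import Data.Nat.Properties as ℕ
  open import Data.Integer using (ℤ; +_; _+_; _*_; -_; _-_)
  open import Data.Integer.Properties using (pos-*; *-zeroʳ; *-identityˡ; *-assoc; +-identityʳ)
  open import Data.Integer.Divisibility.Signed
    using (_∣_; ∣-refl; ∣-trans; ∣m⇒∣m*n; ∣n⇒∣m*n; ∣m∣n⇒∣m+n; ∣m∣n⇒∣m-n; ∣⇒∣ᵤ)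
  open import Relation.Binary.PropositionalEquality
  open import Data.Integer.Tactic.RingSolver using (solve-∀)
  open ≡-Reasoning
  open IntSums
  open Digits using (ones-below-+)

  Φterm : ℤ → ℤ₂ → ℕ → ℤ
  Φterm I x k = (+ digit x k) * (+ (2 ^ k)) * powℤ I (ones-below x k)

  powℤ-+ : ∀ a m n → powℤ a (m ℕ.+ n) ≡ powℤ a m * powℤ a n
  powℤ-+ a ℕ.zero    n = sym (*-identityˡ _)
  powℤ-+ a (ℕ.suc m) n = trans (cong (a *_) (powℤ-+ a m n)) (sym (*-assoc a _ _))

  +2^[m+n] : ∀ m n → + (2 ^ (m ℕ.+ n)) ≡ + (2 ^ m) * + (2 ^ n)
  +2^[m+n] m n = trans (cong +_ (ℕ.^-distribˡ-+-* 2 m n)) (pos-* (2 ^ m) (2 ^ n))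

  ∣-sumℤ : ∀ {d} n {f} → (∀ j → d ∣ f j) → d ∣ sumℤ n f
  ∣-sumℤ {d} ℕ.zero    d∣f = subst (d ∣_) (*-zeroʳ d) (∣m⇒∣m*n (+ 0) ∣-refl)
  ∣-sumℤ     (ℕ.suc n) d∣f = ∣m∣n⇒∣m+n (∣-sumℤ n d∣f) (d∣f n)

  2^k∣Φterm : ∀ I x k → + (2 ^ k) ∣ Φterm I x k
  2^k∣Φterm I x k = ∣m⇒∣m*n (powℤ I (ones-below x k)) (∣n⇒∣m*n (+ digit x k) ∣-refl)

  Φsum-extend : ∀ I x n c → + (2 ^ n) ∣ sumℤ (n ℕ.+ c) (Φterm I x) - sumℤ n (Φterm I x)
  Φsum-extend I x n c =
    subst (+ (2 ^ n) ∣_) tail (∣-sumℤ c (λ j → ∣-trans 2^n∣2^[n+j] (2^k∣Φterm I x (n ℕ.+ j))))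
    where
    2^n∣2^[n+j] : ∀ {j} → + (2 ^ n) ∣ + (2 ^ (n ℕ.+ j))
    2^n∣2^[n+j] {j} = subst (+ (2 ^ n) ∣_) (sym (+2^[m+n] n j)) (∣m⇒∣m*n (+ (2 ^ j)) ∣-refl)
    cancel : ∀ a b → b ≡ (a + b) - a
    cancel = solve-∀
    tail : sumℤ c (λ j → Φterm I x (n ℕ.+ j)) ≡ sumℤ (n ℕ.+ c) (Φterm I x) - sumℤ n (Φterm I x)
    tail = trans (cancel (sumℤ n (Φterm I x)) _)
                 (cong (_- sumℤ n (Φterm I x)) (sym (sumℤ-+ n c (Φterm I x))))

  Φterm-shift : ∀ I {x} s k → (∀ k → digit x (s ℕ.+ k) ≡ digit x k) →
                Φterm I x (s ℕ.+ k) ≡ Φterm I x k * powℤ I (ones-below x s) * + (2 ^ s)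
  Φterm-shift I {x} s k periodic = begin
    (+ digit x (s ℕ.+ k)) * + (2 ^ (s ℕ.+ k)) * powℤ I (ones-below x (s ℕ.+ k))
      ≡⟨ cong₂ (λ d o → (+ d) * + (2 ^ (s ℕ.+ k)) * powℤ I o)
               (periodic k) (ones-below-+ {x} s k periodic) ⟩
    (+ digit x k) * + (2 ^ (s ℕ.+ k)) * powℤ I (ones-below x s ℕ.+ ones-below x k)
      ≡⟨ cong₂ (λ e p → (+ digit x k) * e * p)
               (+2^[m+n] s k) (powℤ-+ I (ones-below x s) (ones-below x k)) ⟩
    (+ digit x k) * (+ (2 ^ s) * + (2 ^ k)) * (powℤ I (ones-below x s) * powℤ I (ones-below x k))
      ≡⟨ rearrange (+ digit x k) (+ (2 ^ s)) (+ (2 ^ k)) _ _ ⟩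
    Φterm I x k * powℤ I (ones-below x s) * + (2 ^ s)
      ∎
    where
    rearrange : ∀ d q e p w → d * (q * e) * (p * w) ≡ d * e * w * p * q
    rearrange = solve-∀

  Φterm-agree : ∀ I {x y} s → (∀ k → k < s → digit y k ≡ digit x k) →
                ∀ k → k < s → Φterm I y k ≡ Φterm I x k
  Φterm-agree I s agree k k<s = cong₂ (λ d o → (+ d) * + (2 ^ k) * powℤ I o) (agree k k<s)
    (NatSums.sumℕ-cong k (λ j j<k → agree j (ℕ.<-trans j<k k<s)))

  Φterm-vanish : ∀ I {y} k → digit y k ≡ 0 → Φterm I y k ≡ + 0
  Φterm-vanish I {y} k d≡0 = cong (λ d → (+ d) * + (2 ^ k) * powℤ I (ones-below y k)) d≡0

  module _ {x y : ℤ₂} (s : ℕ) (periodic : ∀ k → digit x (s ℕ.+ k) ≡ digit x k)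
           (agree : ∀ k → k < s → digit y k ≡ digit x k) (vanish : ∀ k → s ≤ k → digit y k ≡ 0) where

    -- The congruence is a formal identity in I: it does not use that inv3 n inverts 3.
    Φsum-truncation : ∀ I n → let A = sumℤ n (Φterm I y); B = sumℤ n (Φterm I x)
                                  P = powℤ I (ones-below x s) in
                      + (2 ^ n) ∣ (- A) - ((- B) - ((- B) * P) * + (2 ^ s))
    Φsum-truncation I n =
      subst (+ (2 ^ n) ∣_) rearranged (∣m∣n⇒∣m-n (Φsum-extend I y n s) (Φsum-extend I x n s))
      where
      T = Φterm I x
      U = Φterm I y
      A = sumℤ n U
      B = sumℤ n T
      P = powℤ I (ones-below x s)
      Q = + (2 ^ s)
      X = sumℤ s T

      truncated-sum : sumℤ (n ℕ.+ s) U ≡ X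
      truncated-sum = begin
        sumℤ (n ℕ.+ s) U                         ≡⟨ cong (λ l → sumℤ l U) (ℕ.+-comm n s) ⟩
        sumℤ (s ℕ.+ n) U                         ≡⟨ sumℤ-+ s n U ⟩
        sumℤ s U + sumℤ n (λ k → U (s ℕ.+ k))    ≡⟨ cong₂ _+_ (sumℤ-cong s (Φterm-agree I {x} {y} s agree))
                                                              (sumℤ-zeros n high) ⟩
        X + + 0                                  ≡⟨ +-identityʳ X ⟩
        X                                        ∎
        where
        high : ∀ k → U (s ℕ.+ k) ≡ + 0
        high k = Φterm-vanish I {y} (s ℕ.+ k) (vanish (s ℕ.+ k) (ℕ.m≤m+n s k))

      self-similar-sum : sumℤ (n ℕ.+ s) T ≡ X + B * P * Q
      self-similar-sum = begin
        sumℤ (n ℕ.+ s) T                         ≡⟨ cong (λ l → sumℤ l T) (ℕ.+-comm n s) ⟩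
        sumℤ (s ℕ.+ n) T                         ≡⟨ sumℤ-+ s n T ⟩
        X + sumℤ n (λ k → T (s ℕ.+ k))           ≡⟨ cong (λ z → X + z) (sumℤ-cong n (λ k _ → shift k)) ⟩
        X + sumℤ n (λ k → T k * P * Q)           ≡⟨ cong (λ z → X + z) (sumℤ-*ʳ n (λ k → T k * P) Q) ⟨
        X + sumℤ n (λ k → T k * P) * Q           ≡⟨ cong (λ z → X + z * Q) (sumℤ-*ʳ n T P) ⟨
        X + B * P * Q                            ∎
        where
        shift : ∀ k → T (s ℕ.+ k) ≡ T k * P * Q
        shift k = Φterm-shift I {x} s k periodic

      rearranged : (sumℤ (n ℕ.+ s) U - A) - (sumℤ (n ℕ.+ s) T - B) ≡ (- A) - ((- B) - ((- B) * P) * Q)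
      rearranged = begin
        (sumℤ (n ℕ.+ s) U - A) - (sumℤ (n ℕ.+ s) T - B)   ≡⟨ cong₂ (λ u t → (u - A) - (t - B))
                                                                     truncated-sum self-similar-sum ⟩
        (X - A) - ((X + B * P * Q) - B)                   ≡⟨ ring A B X P Q ⟩
        (- A) - ((- B) - ((- B) * P) * Q)                 ∎
        where
        ring : ∀ a b c p q → (c - a) - ((c + b * p * q) - b) ≡ (- a) - ((- b) - ((- b) * p) * q)
        ring = solve-∀

    Φ-truncation : ∀ {m} → ones-below x s ≡ m → Φ y ≈₂ Φ x -₂ (Φ x *₂ (inv3 ^₂ m)) *₂ ι (2 ^ s)
    Φ-truncation refl n = ∣⇒∣ᵤ (Φsum-truncation (inv3 n) n)

open import Data.Nat using (ℕ; _*_; _^_; _<_; NonZero)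

corollary14 : (v t b : ℕ) → .{{_ : NonZero v}} → b < 2 ^ v →
    Φ (ι (bbar b v t)) ≈₂
      Φ (bbar∞ b v) -₂ (Φ (bbar∞ b v) *₂ (inv3 ^₂ (α b * t))) *₂ ι (2 ^ (t * v))
corollary14 v t b b<2^v =
  Truncation.Φ-truncation {bbar∞ b v} {ι (bbar b v t)} (t * v)
    (Digits.periodic-* v (Digits.digit-bbar∞-periodic b<2^v) t)
    (Digits.digit-bbar-< b<2^v t)
    (Digits.digit-bbar-≥ b<2^v t)
    (Digits.ones-below-bbar∞ b<2^v t)
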